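{- Let $G$ be a connected graph of order at least $2$ and $x$ a vertex of $G$. Then, for any choices made in defining $av(G,x)$, \[ av(G,x)\cdot\big(N(G,x)-1\big)\geq N(G-x).\]
   Context: A set of vertices is a connected set if it induces a connected subgraph. $G-x$ is the subgraph induced by $V(G)\setminus\{x\}$; $\mathcal C(G-x)$ is the collection of nonempty connected sets of $G-x$ and $N(G-x)=|\mathcal C(G-x)|$. $\mathcal C(G,x)$ is the collection of connected sets of $G$ containing $x$ and $N(G,x)=|\mathcal C(G,x)|$. Definition of $av(G,x)$: fix a shortest distance spanning tree $T$ of $G$ rooted at $x$ (for each vertex $v$, the path in $T$ from $v$ to $x$ has length equal to the distance from $v$ to $x$ in $G$). For each $U\in\mathcal C(G-x)$ choose a vertex $v_U\in U$ closest to $x$, and let $p_U$ be the path in $T$ between $v_U$ and $x$, regarded as its vertex set; $|p_U|$ denotes its length (number of edges). Let $\overline U=U\cup p_U$. For $Q\in\mathcal C(G,x)$ let $W(Q)=\{U\in\mathcal C(G-x):\overline U=Q\}$, ordered by $U\preceq U'$ iff $p_{U'}\subseteq p_U$; when $W(Q)\ne\emptyset$ let $U_Q$ be the minimal element of $W(Q)$ for this order. Let $\mathcal M(G-x)=\{U_Q: Q\in\mathcal C(G,x),\ W(Q)\neq\emptyset\}$ and \[av(G,x)=\frac{1}{|\mathcal M(G-x)|}\sum_{U\in\mathcal M(G-x)}|p_U|.\] -}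

module Defs where

open import Data.Nat using (ℕ; zero; suc; _≤_)
open import Data.Fin using (Fin)
open import Data.Fin.Subset using (Subset; _∈_; _∉_; _∪_; ⁅_⁆; _⊆_)
open import Data.Product using (Σ; ∃; _×_; _,_)
open import Data.List using (List; length)
open import Data.List.Relation.Unary.Unique.Propositional using (Unique)
open import Relation.Nullary using (¬_)
open import Relation.Binary.PropositionalEquality using (_≡_; _≢_)
open import Function.Bundles using (_⇔_)
import Data.List.Membership.Propositional as LM

record Graph (n : ℕ) : Set₁ where
  field
    Adj    : Fin n → Fin n → Set
    sym    : ∀ {u v} → Adj u v → Adj v u
    irrefl : ∀ {u} → ¬ Adj u u

module _ {n : ℕ} (G : Graph n) where
  open Graph G

  data Walk : Fin n → Fin n → ℕ → Set where
    nil  : ∀ {u} → Walk u u zero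
    cons : ∀ {u w v k} → Adj u w → Walk w v k → Walk u v (suc k)

  Connected : Set
  Connected = ∀ u v → ∃ λ k → Walk u v k

  IsDist : Fin n → Fin n → ℕ → Set
  IsDist u v d = Walk u v d × (∀ m → Walk u v m → d ≤ m)

  data WalkIn (S : Subset n) : Fin n → Fin n → Set where
    here : ∀ {u} → u ∈ S → WalkIn S u u
    step : ∀ {u w v} → u ∈ S → Adj u w → WalkIn S w v → WalkIn S u v

  ConnSet : Subset n → Set
  ConnSet S = (∃ λ v → v ∈ S) × (∀ u v → u ∈ S → v ∈ S → WalkIn S u v)

  -- 𝒞(G - x): nonempty connected sets of G - x
  -- (a subset of V(G)∖{x} induces the same subgraph in G - x as in G)
  CMinus : Fin n → Subset n → Set
  CMinus x U = ConnSet U × x ∉ U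

  CAt : Fin n → Subset n → Set
  CAt x Q = ConnSet Q × x ∈ Q

HasCount : {n : ℕ} → (Subset n → Set) → ℕ → Set
HasCount {n} P k =
  Σ (List (Subset n)) λ L → Unique L × (∀ S → (S LM.∈ L) ⇔ P S) × length L ≡ k

iter : {n : ℕ} → (Fin n → Fin n) → ℕ → Fin n → Fin n
iter f zero v = v
iter f (suc i) v = f (iter f i v)

pathFrom : {n : ℕ} → (Fin n → Fin n) → ℕ → Fin n → Subset n
pathFrom par zero v = ⁅ v ⁆
pathFrom par (suc k) v = ⁅ v ⁆ ∪ pathFrom par k (par v)

-- A shortest distance spanning tree T of G rooted at x, encoded by its
-- parent map `par` (par x = x) and depth `dep`; the T-path from v to x is
-- v, par v, …, x and has length dep v = dist_G(v, x).
record SDTree {n : ℕ} (G : Graph n) (x : Fin n) : Set where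
  field
    par     : Fin n → Fin n
    dep     : Fin n → ℕ
    par-x   : par x ≡ x
    par-adj : ∀ v → v ≢ x → Graph.Adj G v (par v)
    par-dep : ∀ v → v ≢ x → suc (dep (par v)) ≡ dep v
    dep-dist : ∀ v → IsDist G v x (dep v)

  pathSet : Fin n → Subset n
  pathSet v = pathFrom par (dep v) v

record AvChoices {n : ℕ} (G : Graph n) (x : Fin n) : Set where
  field
    T : SDTree G x
  open SDTree T public
  field
    vch      : Subset n → Fin n
    vch-in   : ∀ U → CMinus G x U → vch U ∈ U
    vch-min  : ∀ U → CMinus G x U → ∀ w → w ∈ U → dep (vch U) ≤ dep w

  pU : Subset n → Subset n
  pU U = pathSet (vch U)

  lenP : Subset n → ℕ
  lenP U = dep (vch U)

  bar : Subset n → Subset n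
  bar U = U ∪ pU U

  InW : Subset n → Subset n → Set
  InW Q U = CMinus G x U × bar U ≡ Q

  _⪯_ : Subset n → Subset n → Set
  U ⪯ U' = pU U' ⊆ pU U

  field
    sel     : Subset n → Subset n
    sel-in  : ∀ Q → CAt G x Q → (∃ λ U → InW Q U) → InW Q (sel Q)
    sel-min : ∀ Q → CAt G x Q → (∃ λ U → InW Q U) →
              ∀ U → InW Q U → U ⪯ sel Q → sel Q ⪯ U

  InM : Subset n → Set
  InM U = ∃ λ Q → CAt G x Q × (∃ λ U' → InW Q U') × U ≡ sel Q

-- Two counting bounds whose product is the claim.  First, U ∈ 𝒞(G - x) is
-- determined by the pair (Ū, |p_U|), and minimality of U_Q forces
-- |p_U| ≤ |p_{U_Ū}|; so U ↦ (U_Ū, |p_U|) injects 𝒞(G - x) into the pairs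
-- (V, j) with V ∈ ℳ(G - x) and 1 ≤ j ≤ |p_V|, giving
-- N(G - x) ≤ Σ_{V ∈ ℳ} |p_V|.  Second, V ↦ V̄ injects ℳ(G - x) into
-- 𝒞(G, x) ∖ {{x}}, giving |ℳ(G - x)| ≤ N(G, x) - 1.
module Submission where

open import Defs
open import Data.Nat using (ℕ; zero; suc; _+_; _*_; _∸_; _≤_; _<_; z≤n; s≤s)
open import Data.Nat.Properties using (*-mono-≤; n≤0⇒n≡0; suc-injective; 0≢1+n; <⇒≱; ≮⇒≥; ≤-reflexive; <⇒≤; m<n⇒m<1+n)
open import Data.Fin using (Fin)
open import Data.Fin.Subset using (Subset; ⁅_⁆; _⊆_) renaming (_∈_ to _∈ₛ_)
open import Data.Fin.Subset.Properties using (x∈⁅x⁆; x∈⁅y⁆⇒x≡y; ⊆-antisym; ⊆-reflexive; p⊆p∪q; q⊆p∪q; x∈p∪q⁻)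
open import Data.List using (List; []; _∷_; map; length; _++_; applyUpTo)
open import Data.Nat.ListAction using (sum)
open import Data.List.Relation.Unary.Unique.Propositional using (Unique)
open import Data.List.Relation.Unary.AllPairs using (_∷_)
import Data.List.Relation.Unary.All as All
open import Data.List.Relation.Unary.Any using (here; there; index; _─_)
open import Data.List.Properties using (length-++; length-applyUpTo; length-removeAt′)
open import Data.List.Membership.Propositional using (_∈_)
open import Data.List.Membership.Propositional.Properties using (∈-applyUpTo⁺; ∈-++⁺ˡ; ∈-++⁺ʳ)
open import Data.Product using (_×_; _,_; proj₁; proj₂)
open import Data.Sum using (_⊎_; inj₁; inj₂)
open import Data.Empty using (⊥-elim)
open import Relation.Nullary using (¬_)
open import Relation.Binary.PropositionalEquality using (_≡_; _≢_; refl; sym; trans; cong; cong₂; subst)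
open import Function.Bundles using (_⇔_; Equivalence)
open import Function.Base using (_∘_)
import Data.List.Membership.Propositional as LM

∈-─⁺ : {A : Set} {a b : A} {ys : List A} (a∈ys : a ∈ ys) → b ∈ ys → a ≢ b → b ∈ (ys ─ a∈ys)
∈-─⁺ (here refl)  (here refl)  a≢b = ⊥-elim (a≢b refl)
∈-─⁺ (here _)     (there b∈ys) _   = b∈ys
∈-─⁺ (there _)    (here b≡y)   _   = here b≡y
∈-─⁺ (there a∈ys) (there b∈ys) a≢b = there (∈-─⁺ a∈ys b∈ys a≢b)

module _ {A : Set} where

  length-≤-injection : {B : Set} (f : A → B) {xs : List A} {ys : List B} → Unique xs →
    (∀ {a b} → a ∈ xs → b ∈ xs → f a ≡ f b → a ≡ b) →
    (∀ {a} → a ∈ xs → f a ∈ ys) → length xs ≤ length ys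
  length-≤-injection f {[]} _ _ _ = z≤n
  length-≤-injection f {a ∷ xs} {ys} (a∉xs ∷ unique) injective into =
    subst (suc (length xs) ≤_) (sym (length-removeAt′ ys (index fa∈ys)))
      (s≤s (length-≤-injection f unique
        (λ b∈xs c∈xs → injective (there b∈xs) (there c∈xs))
        (λ b∈xs → ∈-─⁺ fa∈ys (into (there b∈xs))
          (λ fa≡fb → All.lookup a∉xs b∈xs (injective (here refl) (there b∈xs) fa≡fb)))))
    where fa∈ys = into (here refl)

  latticeUnder : (A → ℕ) → List A → List (A × ℕ)
  latticeUnder h []       = []
  latticeUnder h (a ∷ as) = applyUpTo (λ i → a , suc i) (h a) ++ latticeUnder h as

  length-latticeUnder : ∀ h as → length (latticeUnder h as) ≡ sum (map h as)
  length-latticeUnder h []       = refl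
  length-latticeUnder h (a ∷ as) =
    trans (length-++ (applyUpTo (λ i → a , suc i) (h a)))
          (cong₂ _+_ (length-applyUpTo _ (h a)) (length-latticeUnder h as))

  ∈-latticeUnder : ∀ {h a as j} → a ∈ as → 1 ≤ j → j ≤ h a → (a , j) ∈ latticeUnder h as
  ∈-latticeUnder (here refl) (s≤s z≤n) j≤ha = ∈-++⁺ˡ (∈-applyUpTo⁺ _ j≤ha)
  ∈-latticeUnder {h} {as = b ∷ _} (there a∈as) 1≤j j≤ha =
    ∈-++⁺ʳ (applyUpTo (λ i → b , suc i) (h b)) (∈-latticeUnder a∈as 1≤j j≤ha)

module _ {n : ℕ} {G : Graph n} where
  open Graph G using () renaming (sym to Adj-sym)

  WalkIn-mono : ∀ {S S' u v} → S ⊆ S' → WalkIn G S u v → WalkIn G S' u v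
  WalkIn-mono S⊆S' (here u∈S)     = here (S⊆S' u∈S)
  WalkIn-mono S⊆S' (step u∈S a w) = step (S⊆S' u∈S) a (WalkIn-mono S⊆S' w)

  WalkIn-++ : ∀ {S u v w} → WalkIn G S u v → WalkIn G S v w → WalkIn G S u w
  WalkIn-++ (here _)       w' = w'
  WalkIn-++ (step u∈S a w) w' = step u∈S a (WalkIn-++ w w')

  WalkIn-start : ∀ {S u v} → WalkIn G S u v → u ∈ₛ S
  WalkIn-start (here u∈S)     = u∈S
  WalkIn-start (step u∈S _ _) = u∈S

  WalkIn-reverse : ∀ {S u v} → WalkIn G S u v → WalkIn G S v u
  WalkIn-reverse (here u∈S)     = here u∈S
  WalkIn-reverse (step u∈S a w) =
    WalkIn-++ (WalkIn-reverse w) (step (WalkIn-start w) (Adj-sym a) (here u∈S))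

  hub⇒ConnSet : ∀ {S c} → c ∈ₛ S → (∀ w → w ∈ₛ S → WalkIn G S w c) → ConnSet G S
  hub⇒ConnSet {c = c} c∈S toHub =
    (c , c∈S) , λ u v u∈S v∈S → WalkIn-++ (toHub u u∈S) (WalkIn-reverse (toHub v v∈S))

  ⁅⁆-CAt : ∀ x → CAt G x ⁅ x ⁆
  ⁅⁆-CAt x = hub⇒ConnSet (x∈⁅x⁆ x) toX , x∈⁅x⁆ x
    where
      toX : ∀ w → w ∈ₛ ⁅ x ⁆ → WalkIn G ⁅ x ⁆ w x
      toX w w∈⁅x⁆ with x∈⁅y⁆⇒x≡y x w∈⁅x⁆
      ... | refl = here w∈⁅x⁆

module _ {n : ℕ} {G : Graph n} {x : Fin n} (T : SDTree G x) where
  open SDTree T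

  dep≡0⇒≡x : ∀ {v} → dep v ≡ 0 → v ≡ x
  dep≡0⇒≡x {v} dv≡0 = walk0 (subst (Walk G v x) dv≡0 (proj₁ (dep-dist v)))
    where
      walk0 : ∀ {u} → Walk G u x 0 → u ≡ x
      walk0 nil = refl

  dep≡suc⇒≢x : ∀ {v k} → dep v ≡ suc k → v ≢ x
  dep≡suc⇒≢x dv≡1+k refl = 0≢1+n (trans (sym (n≤0⇒n≡0 (proj₂ (dep-dist x) 0 nil))) dv≡1+k)

  dep-par : ∀ {v k} → dep v ≡ suc k → dep (par v) ≡ k
  dep-par {v} dv≡1+k = suc-injective (trans (par-dep v (dep≡suc⇒≢x dv≡1+k)) dv≡1+k)

  ∈-pathFrom⁻ : ∀ {k v w} → w ∈ₛ pathFrom par (suc k) v → w ≡ v ⊎ w ∈ₛ pathFrom par k (par v)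
  ∈-pathFrom⁻ {k} {v} w∈p with x∈p∪q⁻ ⁅ v ⁆ (pathFrom par k (par v)) w∈p
  ... | inj₁ w∈⁅v⁆ = inj₁ (x∈⁅y⁆⇒x≡y v w∈⁅v⁆)
  ... | inj₂ w∈p'  = inj₂ w∈p'

  start∈pathFrom : ∀ k v → v ∈ₛ pathFrom par k v
  start∈pathFrom zero    v = x∈⁅x⁆ v
  start∈pathFrom (suc k) v = p⊆p∪q _ (x∈⁅x⁆ v)

  x∈pathFrom : ∀ {k v} → dep v ≡ k → x ∈ₛ pathFrom par k v
  x∈pathFrom {zero}  {v} dv≡0 rewrite dep≡0⇒≡x dv≡0 = x∈⁅x⁆ x
  x∈pathFrom {suc k} {v} dv≡1+k = q⊆p∪q ⁅ v ⁆ _ (x∈pathFrom (dep-par dv≡1+k))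

  pathFrom-below : ∀ {k v w} → dep v ≡ k → w ∈ₛ pathFrom par k v → w ≡ v ⊎ dep w < k
  pathFrom-below {zero} {v} _ w∈p = inj₁ (x∈⁅y⁆⇒x≡y v w∈p)
  pathFrom-below {suc k} dv≡1+k w∈p with ∈-pathFrom⁻ {k} w∈p
  ... | inj₁ w≡v = inj₁ w≡v
  ... | inj₂ w∈p' with pathFrom-below (dep-par dv≡1+k) w∈p'
  ...   | inj₁ refl = inj₂ (s≤s (≤-reflexive (dep-par dv≡1+k)))
  ...   | inj₂ dw<k = inj₂ (m<n⇒m<1+n dw<k)

  pathSet-⊆ : ∀ {k v w} → dep v ≡ k → w ∈ₛ pathFrom par k v → pathSet w ⊆ pathFrom par k v
  pathSet-⊆ {zero} {v} dv≡0 w∈p with x∈⁅y⁆⇒x≡y v w∈p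
  ... | refl = ⊆-reflexive (cong (λ j → pathFrom par j v) dv≡0)
  pathSet-⊆ {suc k} {v} dv≡1+k w∈p with ∈-pathFrom⁻ {k} w∈p
  ... | inj₁ refl = ⊆-reflexive (cong (λ j → pathFrom par j v) dv≡1+k)
  ... | inj₂ w∈p' = λ y∈ → q⊆p∪q ⁅ v ⁆ _ (pathSet-⊆ (dep-par dv≡1+k) w∈p' y∈)

  pathFrom-walk : ∀ {k v} → dep v ≡ k → WalkIn G (pathFrom par k v) v x
  pathFrom-walk {zero}  {v} dv≡0 rewrite dep≡0⇒≡x dv≡0 = here (x∈⁅x⁆ x)
  pathFrom-walk {suc k} {v} dv≡1+k =
    step (start∈pathFrom (suc k) v) (par-adj v (dep≡suc⇒≢x dv≡1+k))
      (WalkIn-mono (q⊆p∪q ⁅ v ⁆ _) (pathFrom-walk (dep-par dv≡1+k)))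

  pathSet-walk : ∀ v → WalkIn G (pathSet v) v x
  pathSet-walk v = pathFrom-walk refl

module _ {n : ℕ} {G : Graph n} {x : Fin n} (ch : AvChoices G x) where
  open AvChoices ch

  lenP-positive : ∀ {U} → CMinus G x U → 1 ≤ lenP U
  lenP-positive {U} cU with lenP U in lenP≡
  ... | zero  = ⊥-elim (proj₂ cU (subst (_∈ₛ U) (dep≡0⇒≡x T lenP≡) (vch-in U cU)))
  ... | suc _ = s≤s z≤n

  bar-CAt : ∀ {U} → CMinus G x U → CAt G x (bar U)
  bar-CAt {U} cU = hub⇒ConnSet x∈bar toX , x∈bar
    where
      x∈bar : x ∈ₛ bar U
      x∈bar = q⊆p∪q U _ (x∈pathFrom T refl)

      toX : ∀ w → w ∈ₛ bar U → WalkIn G (bar U) w x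
      toX w w∈bar with x∈p∪q⁻ U (pU U) w∈bar
      ... | inj₁ w∈U  = WalkIn-++ (WalkIn-mono (p⊆p∪q _) (proj₂ (proj₁ cU) w (vch U) w∈U (vch-in U cU)))
                                  (WalkIn-mono (q⊆p∪q U _) (pathSet-walk T (vch U)))
      ... | inj₂ w∈pU = WalkIn-mono (q⊆p∪q U _) (WalkIn-mono (pathSet-⊆ T refl w∈pU) (pathSet-walk T w))

  sel-bar-InW : ∀ {U} → CMinus G x U → InW (bar U) (sel (bar U))
  sel-bar-InW {U} cU = sel-in (bar U) (bar-CAt cU) (U , cU , refl)

  sel-bar-InM : ∀ {U} → CMinus G x U → InM (sel (bar U))
  sel-bar-InM {U} cU = bar U , bar-CAt cU , (U , cU , refl) , refl

  -- If v_S were strictly closer to x than v_U, then v_S ∈ p_U (it cannot lie in U),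
  -- so U ⪯ S, and minimality of S = U_Ū would put v_U on the strictly shorter path p_S.
  lenP≤lenP-sel-bar : ∀ {U} → CMinus G x U → lenP U ≤ lenP (sel (bar U))
  lenP≤lenP-sel-bar {U} cU = ≮⇒≥ closer-impossible
    where
      S = sel (bar U)
      s = vch S
      s∈bar : s ∈ₛ bar U
      s∈bar with sel-bar-InW cU
      ... | cS , barS≡barU = subst (s ∈ₛ_) barS≡barU (p⊆p∪q _ (vch-in S cS))

      closer-impossible : ¬ dep s < dep (vch U)
      closer-impossible s<v with x∈p∪q⁻ U (pU U) s∈bar
      ... | inj₁ s∈U  = <⇒≱ s<v (vch-min U cU s s∈U)
      ... | inj₂ s∈pU
          with pathFrom-below T refl
                 (sel-min (bar U) (bar-CAt cU) (U , cU , refl) U (cU , refl)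
                          (pathSet-⊆ T refl s∈pU) (start∈pathFrom T (lenP U) (vch U)))
      ...   | inj₁ v≡s = <⇒≱ s<v (≤-reflexive (cong dep v≡s))
      ...   | inj₂ v<s = <⇒≱ s<v (<⇒≤ v<s)

  bar-lenP-⊆ : ∀ {U U'} → CMinus G x U → CMinus G x U' →
               bar U ≡ bar U' → lenP U ≡ lenP U' → U ⊆ U'
  bar-lenP-⊆ {U} {U'} cU cU' bar≡ lenP≡ {w} w∈U with x∈p∪q⁻ U' (pU U') (subst (w ∈ₛ_) bar≡ (p⊆p∪q _ w∈U))
  ... | inj₁ w∈U'  = w∈U'
  ... | inj₂ w∈pU' with pathFrom-below T refl w∈pU'
  ...   | inj₁ refl = vch-in U' cU'
  ...   | inj₂ w<v' = ⊥-elim (<⇒≱ w<v' (subst (_≤ dep w) lenP≡ (vch-min U cU w w∈U)))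

  bar-lenP-injective : ∀ {U U'} → CMinus G x U → CMinus G x U' →
                       bar U ≡ bar U' → lenP U ≡ lenP U' → U ≡ U'
  bar-lenP-injective cU cU' bar≡ lenP≡ =
    ⊆-antisym (bar-lenP-⊆ cU cU' bar≡ lenP≡) (bar-lenP-⊆ cU' cU (sym bar≡) (sym lenP≡))

  InM-bar : ∀ {U} → InM U → CMinus G x U × CAt G x (bar U) × sel (bar U) ≡ U
  InM-bar (Q , CAt-Q , nonempty , refl) with sel-in Q CAt-Q nonempty
  ... | cU , bar≡Q = cU , subst (CAt G x) (sym bar≡Q) CAt-Q , cong sel bar≡Q

  bar≢⁅x⁆ : ∀ {U} → CMinus G x U → bar U ≢ ⁅ x ⁆
  bar≢⁅x⁆ {U} (((w , w∈U) , _) , x∉U) bar≡⁅x⁆ =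
    x∉U (subst (_∈ₛ U) (x∈⁅y⁆⇒x≡y x (subst (w ∈ₛ_) bar≡⁅x⁆ (p⊆p∪q _ w∈U))) w∈U)

  count-CMinus≤ : ∀ {N M} → HasCount (CMinus G x) N → (∀ {U} → InM U → U ∈ M) →
                  N ≤ sum (map lenP M)
  count-CMinus≤ {M = M} (L , unique , L⇔ , refl) M⊇ℳ =
    subst (length L ≤_) (length-latticeUnder lenP M)
      (length-≤-injection (λ U → sel (bar U) , lenP U) unique injective into)
    where
      cm : ∀ {U} → U ∈ L → CMinus G x U
      cm {U} = Equivalence.to (L⇔ U)

      injective : ∀ {U U'} → U ∈ L → U' ∈ L →
                  (sel (bar U) , lenP U) ≡ (sel (bar U') , lenP U') → U ≡ U'
      injective U∈L U'∈L pair≡ = bar-lenP-injective cU cU'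
        (trans (sym (proj₂ (sel-bar-InW cU)))
               (trans (cong (bar ∘ proj₁) pair≡) (proj₂ (sel-bar-InW cU'))))
        (cong proj₂ pair≡)
        where cU = cm U∈L ; cU' = cm U'∈L

      into : ∀ {U} → U ∈ L → (sel (bar U) , lenP U) ∈ latticeUnder lenP M
      into U∈L = ∈-latticeUnder (M⊇ℳ (sel-bar-InM cU)) (lenP-positive cU) (lenP≤lenP-sel-bar cU)
        where cU = cm U∈L

  length-ℳ≤ : ∀ {N M} → HasCount (CAt G x) N → Unique M → (∀ {U} → U ∈ M → InM U) →
              length M ≤ N ∸ 1
  length-ℳ≤ {M = M} (L , _ , L⇔ , refl) unique M⊆ℳ =
    subst (length M ≤_) (cong (_∸ 1) (sym (length-removeAt′ L (index ⁅x⁆∈L))))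
      (length-≤-injection bar unique injective into)
    where
      ⁅x⁆∈L : ⁅ x ⁆ ∈ L
      ⁅x⁆∈L = Equivalence.from (L⇔ ⁅ x ⁆) (⁅⁆-CAt x)

      injective : ∀ {U U'} → U ∈ M → U' ∈ M → bar U ≡ bar U' → U ≡ U'
      injective U∈M U'∈M bar≡ =
        trans (sym (proj₂ (proj₂ (InM-bar (M⊆ℳ U∈M)))))
              (trans (cong sel bar≡) (proj₂ (proj₂ (InM-bar (M⊆ℳ U'∈M)))))

      into : ∀ {U} → U ∈ M → bar U ∈ (L ─ ⁅x⁆∈L)
      into U∈M with InM-bar (M⊆ℳ U∈M)
      ... | cU , CAt-bar , _ =
        ∈-─⁺ ⁅x⁆∈L (Equivalence.from (L⇔ _) CAt-bar) (λ ⁅x⁆≡bar → bar≢⁅x⁆ cU (sym ⁅x⁆≡bar))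

theorem5p1 : (n : ℕ) → 2 ≤ n → (G : Graph n) → Connected G → (x : Fin n) →
    (ch : AvChoices G x) →
    (NGx NGmx : ℕ) → HasCount (CAt G x) NGx → HasCount (CMinus G x) NGmx →
    (M : List (Subset n)) → Unique M →
    (∀ U → (U LM.∈ M) ⇔ AvChoices.InM ch U) →
    NGmx * length M ≤ sum (map (AvChoices.lenP ch) M) * (NGx ∸ 1)
theorem5p1 _ _ _ _ _ ch _ _ countCAt countCMinus _ unique M⇔ℳ =
  *-mono-≤ (count-CMinus≤ ch countCMinus (Equivalence.from (M⇔ℳ _)))
           (length-ℳ≤ ch countCAt unique (Equivalence.to (M⇔ℳ _)))
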